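{- A Sharing Nim position $(x,y,z)$ with $x\le y\le z$ has Sprague–Grundy value $1$ if and only if the multiset $\{0,\,y-x,\,z-x\}$ equals one of the multisets $\{0,0,4k+2\}$, $\{0,4k+2,4k+2\}$, $\{0,2,4k+1\}$ for some integer $k\ge 0$, or $\{0,4l-1,4l+1\}$ for some integer $l\ge 1$.
   Context: Three-pile Sharing Nim: a position is a triple of nonnegative integers (pile sizes; order irrelevant). A move takes some positive number $k$ of tokens from one pile and adds them to another pile, provided that after the move the receiving pile does not have more tokens than the source pile; i.e. from $(a,b,c)$ with $a\le b\le c$ one may move to $(a+k,b-k,c)$ with $1\le k\le (b-a)/2$, to $(a+k,b,c-k)$ with $1\le k\le (c-a)/2$, or to $(a,b+k,c-k)$ with $1\le k\le (c-b)/2$. Normal play. The Sprague–Grundy value is $\mathcal{G}(p)=\operatorname{mex}\{\mathcal{G}(q): q \text{ reachable from } p \text{ in one move}\}$, where $\operatorname{mex}(S)$ is the least nonnegative integer not in $S$. -}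

module Defs where

open import Data.Nat using (ℕ; zero; suc; _+_; _*_; _∸_; _≤_; _<_)
open import Data.Product using (Σ; _×_; _,_)
open import Relation.Binary.PropositionalEquality using (_≡_; _≢_)

-- A position: sizes of three (labelled) piles.  Labelling does not affect
-- the game: moves are allowed between any ordered pair of distinct piles.
Pos : Set
Pos = ℕ × ℕ × ℕ

-- One Sharing Nim move: take k ≥ 1 tokens from a source pile (which had
-- s + k tokens, s afterwards) and add them to a receiving pile (r tokens
-- before, r + k afterwards), provided r + k ≤ s (the receiving pile does not
-- end up with more tokens than the source pile).
data _⟶_ : Pos → Pos → Set where
  mv21 : ∀ {a b c k} → 1 ≤ k → a + k ≤ b → (a , b + k , c) ⟶ (a + k , b , c)
  mv31 : ∀ {a b c k} → 1 ≤ k → a + k ≤ c → (a , b , c + k) ⟶ (a + k , b , c)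
  mv12 : ∀ {a b c k} → 1 ≤ k → b + k ≤ a → (a + k , b , c) ⟶ (a , b + k , c)
  mv32 : ∀ {a b c k} → 1 ≤ k → b + k ≤ c → (a , b , c + k) ⟶ (a , b + k , c)
  mv13 : ∀ {a b c k} → 1 ≤ k → c + k ≤ a → (a + k , b , c) ⟶ (a , b , c + k)
  mv23 : ∀ {a b c k} → 1 ≤ k → c + k ≤ b → (a , b + k , c) ⟶ (a , b , c + k)

-- Sprague–Grundy value, as an inductive relation:  SG p n  means
-- n = mex { SG-value of q : p ⟶ q }, i.e. every option has a value ≠ n and
-- every m < n is the value of some option.  Since the game is well founded
-- (the sum of squares of pile sizes strictly decreases), this relation is
-- total and functional, i.e. SG p n  ⇔  𝒢(p) = n.
data SG : Pos → ℕ → Set where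
  sg : ∀ {p n}
     → (∀ {q} → p ⟶ q → Σ ℕ (λ m → SG q m × m ≢ n))
     → (∀ {m} → m < n → Σ Pos (λ q → (p ⟶ q) × SG q m))
     → SG p n

-- Sharing Nim only depends on the gaps u = y ∸ x and v = z ∸ y between the sorted piles,
-- and the moves of a position correspond exactly to the moves of a game on gaps.  In the
-- gap game, the pairs (0 , v) and (v , 0) with v = 0 or of even 2-adic valuation form an
-- independent set reachable from every other pair, so they are the positions of value 0.
-- The pairs (0 , 4k+2), (1 , 1), (2 , 4k+3) and their mirror images form an independent
-- set, each of them reaches a position of value 0, and every other position reaches one of
-- them or has value 0; so they are the positions of value 1.  Termination comes from the
-- sum of the squares of the piles, which every move decreases.

module Submission where

open import Defs
open import Data.Nat using (ℕ; zero; suc; _+_; _*_; _∸_; _≤_; _<_; z≤n; s≤s; _≤?_; _⊓_; _⊔_; _%_; NonZero; >-nonZero⁻¹)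
open import Data.Nat.Properties
open import Data.Nat.DivMod using ([m+kn]%n≡m%n)
open import Data.Nat.Induction using (<-rec; <-wellFounded)
open import Data.Nat.ListAction using (sum)
open import Data.Nat.Tactic.RingSolver using (solve-∀; solve)
open import Algebra.Properties.CommutativeSemigroup +-commutativeSemigroup using (xy∙z≈xz∙y)
open import Induction.WellFounded using (Acc; acc)
open import Data.List using (List; _∷_; []; map; filter; upTo; concat)
open import Data.List.Membership.Propositional using (_∈_; _∉_; mapWith∈)
open import Data.List.Membership.Propositional.Properties
  using (∈-map⁺; ∈-map⁻; ∈-concat⁺′; ∈-concat⁻′; ∈-filter⁺; ∈-filter⁻; ∈-upTo⁺; ∈-upTo⁻)
open import Data.List.Membership.DecPropositional _≟_ using (_∈?_)
open import Data.List.Relation.Unary.Any using (here; there)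
open import Data.List.Relation.Unary.Any.Properties using (mapWith∈⁺; mapWith∈⁻)
open import Data.List.Relation.Binary.Permutation.Propositional
  using (_↭_; ↭-refl; ↭-prep; ↭-swap; ↭-trans; ↭-reflexive; ↭⇒↭ₛ)
open import Data.List.Relation.Binary.Equality.Propositional using (≋⇒≡)
open import Data.List.Relation.Unary.Linked using ([-]) renaming (_∷_ to _∷↗_)
open import Data.List.Relation.Unary.Sorted.TotalOrder.Properties using (↗↭↗⇒≋)
open import Data.Product using (Σ; ∃; ∃-syntax; _×_; _,_; proj₁; proj₂; swap)
open import Data.Sum using (_⊎_; inj₁; inj₂)
import Data.Sum as Sum
open import Data.Empty using (⊥; ⊥-elim)
open import Function using (_∘_; id)
open import Function.Bundles using (_⇔_; mk⇔; Equivalence)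
open import Function.Properties.Equivalence using () renaming (trans to ⇔-trans)
open import Relation.Nullary using (¬_; yes; no)
open import Relation.Binary.Definitions using (tri<; tri≈; tri>)
open import Relation.Binary.PropositionalEquality

-- Parity, residues and the 2-adic valuation

data Halving : ℕ → Set where
  even : ∀ q → Halving (2 * q)
  odd  : ∀ q → Halving (2 * q + 1)

halve : ∀ n → Halving n
halve zero = even 0
halve (suc n) with halve n
... | even q = subst Halving (+-comm (2 * q) 1) (odd q)
... | odd q = subst Halving (2*[1+q]≡2*q+1+1 q) (even (suc q))
  where
  2*[1+q]≡2*q+1+1 : ∀ q → 2 * suc q ≡ suc (2 * q + 1)
  2*[1+q]≡2*q+1+1 = solve-∀

[d*k+r]%d≡r%d : ∀ d k r .{{_ : NonZero d}} → (d * k + r) % d ≡ r % d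
[d*k+r]%d≡r%d d k r =
  trans (cong (_% d) (trans (+-comm (d * k) r) (cong (r +_) (*-comm d k)))) ([m+kn]%n≡m%n r k d)

mod-clash : ∀ d {x} a b {r s} .{{_ : NonZero d}} → r % d ≢ s % d → x ≡ d * a + r → x ≡ d * b + s → ⊥
mod-clash d a b {r} {s} r≢s x≡ x≡′ =
  r≢s (trans (sym ([d*k+r]%d≡r%d d a r)) (trans (cong (_% d) (trans (sym x≡) x≡′)) ([d*k+r]%d≡r%d d b s)))

data Even-ν₂ : ℕ → Set where
  ν₂-zero : Even-ν₂ 0
  ν₂-odd  : ∀ q → Even-ν₂ (2 * q + 1)
  ν₂-×4   : ∀ {m} → 1 ≤ m → Even-ν₂ m → Even-ν₂ (2 * (2 * m))

Even-ν₂-¬double : ∀ {n m} → Even-ν₂ n → n ≡ 2 * m → 1 ≤ m → ¬ Even-ν₂ m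
Even-ν₂-¬double ν₂-zero () (s≤s z≤n) _
Even-ν₂-¬double {m = m} (ν₂-odd q) e _ _ = mod-clash 2 q m (λ ()) refl (trans e (sym (+-identityʳ (2 * m))))
Even-ν₂-¬double (ν₂-×4 _ _) _ () ν₂-zero
Even-ν₂-¬double (ν₂-×4 {m'} _ _) e _ (ν₂-odd q) =
  mod-clash 4 m' q {0} {2} (λ ()) (trans (sym e) (solve (m' ∷ []))) (solve (q ∷ []))
Even-ν₂-¬double (ν₂-×4 {m'} _ E') e _ (ν₂-×4 {m''} h'' E'') =
  Even-ν₂-¬double E' (*-cancelˡ-≡ m' (2 * m'') 2 (*-cancelˡ-≡ (2 * m') (2 * (2 * m'')) 2 e)) h'' E''

Even-ν₂-dichotomy : ∀ n → Even-ν₂ n ⊎ ∃[ m ] (1 ≤ m × n ≡ 2 * m × Even-ν₂ m)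
Even-ν₂-dichotomy = <-rec _ step
  where
  1+r<4[1+r] : ∀ r → suc r < 2 * (2 * suc r)
  1+r<4[1+r] r = ≤-trans (m<m*n (suc r) 4 (s≤s (s≤s z≤n))) (≤-reflexive (solve (r ∷ [])))
  step : ∀ n → (∀ {k} → k < n → Even-ν₂ k ⊎ ∃[ m ] (1 ≤ m × k ≡ 2 * m × Even-ν₂ m)) →
         Even-ν₂ n ⊎ ∃[ m ] (1 ≤ m × n ≡ 2 * m × Even-ν₂ m)
  step n rec with halve n
  ... | odd q = inj₁ (ν₂-odd q)
  ... | even q with halve q
  ...   | odd r = inj₂ (2 * r + 1 , subst (1 ≤_) (+-comm 1 (2 * r)) (s≤s z≤n) , refl , ν₂-odd r)
  ...   | even zero = inj₁ ν₂-zero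
  ...   | even (suc r) with rec (1+r<4[1+r] r)
  ...     | inj₁ E = inj₁ (ν₂-×4 (s≤s z≤n) E)
  ...     | inj₂ (m , h , e , E) =
    inj₂ (2 * suc r , s≤s z≤n , refl , subst (λ x → Even-ν₂ (2 * x)) (sym e) (ν₂-×4 h E))

-- The game on gaps

Gaps : Set
Gaps = ℕ × ℕ

-- (u , v) stands for sorted piles a ≤ a + u ≤ a + u + v.  Taking tokens from the
-- highest pile to the lowest one can make the receiver overtake the middle pile or
-- the source fall below it.
infix 4 _⇒_
data _⇒_ : Gaps → Gaps → Set where
  mid→low  : ∀ {u v u' v'} k → 1 ≤ k → u ≡ u' + 2 * k → v' ≡ v + k → (u , v) ⇒ (u' , v')
  high→mid : ∀ {u v u' v'} k → 1 ≤ k → v ≡ v' + 2 * k → u' ≡ u + k → (u , v) ⇒ (u' , v')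
  high→low : ∀ {u v u' v'} k → 1 ≤ k → u ≡ u' + k → v ≡ v' + k → (u , v) ⇒ (u' , v')
  high→low-overtaking  : ∀ {u v u' v'} j → 1 ≤ j → v ≡ u + 2 * j + v' → u' ≡ j → (u , v) ⇒ (u' , v')
  high→low-undercutting : ∀ {u v u' v'} j → 1 ≤ j → u ≡ v + 2 * j + u' → v' ≡ j → (u , v) ⇒ (u' , v')

-- Reflecting the piles (x ↦ c ∸ x) exchanges the two gaps.
⇒-swap : ∀ {w w'} → w ⇒ w' → swap w ⇒ swap w'
⇒-swap (mid→low k h e e') = high→mid k h e e'
⇒-swap (high→mid k h e e') = mid→low k h e e'
⇒-swap (high→low k h e e') = high→low k h e' e
⇒-swap (high→low-overtaking j h e e') = high→low-undercutting j h e e'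
⇒-swap (high→low-undercutting j h e e') = high→low-overtaking j h e e'

Reaches : (Gaps → Set) → Gaps → Set
Reaches X w = ∃[ w' ] (w ⇒ w' × X w')

Reaches-swap : ∀ {X : Gaps → Set} {w} → (∀ {w} → X w → X (swap w)) → Reaches X w → Reaches X (swap w)
Reaches-swap X-swap (w' , mv , x) = swap w' , ⇒-swap mv , X-swap x

by-symmetry : (Q : Gaps → Set) → (∀ {w} → Q w → Q (swap w)) → (∀ {u v} → u ≤ v → Q (u , v)) → ∀ w → Q w
by-symmetry Q Q-swap Q≤ (u , v) with ≤-total u v
... | inj₁ u≤v = Q≤ u≤v
... | inj₂ v≤u = Q-swap (Q≤ v≤u)

x+k≢0 : ∀ x {k} → 1 ≤ k → x + k ≢ 0
x+k≢0 x (s≤s z≤n) = m+1+n≢0 x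

1≤2*k : ∀ {k} → 1 ≤ k → 1 ≤ 2 * k
1≤2*k (s≤s z≤n) = s≤s z≤n

-- Value 0 in the gap game

data Value₀ : Gaps → Set where
  [0,v] : ∀ {v} → Even-ν₂ v → Value₀ (0 , v)
  [u,0] : ∀ {u} → Even-ν₂ u → Value₀ (u , 0)

Value₀-swap : ∀ {w} → Value₀ w → Value₀ (swap w)
Value₀-swap ([0,v] E) = [u,0] E
Value₀-swap ([u,0] E) = [0,v] E

[0,v]-¬Value₀-option : ∀ {v w'} → Even-ν₂ v → (0 , v) ⇒ w' → ¬ Value₀ w'
[0,v]-¬Value₀-option _ (mid→low {u' = u'} _ h e _) _ = x+k≢0 u' (1≤2*k h) (sym e)
[0,v]-¬Value₀-option _ (high→mid _ h _ refl) ([0,v] _) = n≮0 h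
[0,v]-¬Value₀-option E (high→mid _ h e refl) ([u,0] E') = Even-ν₂-¬double E e h E'
[0,v]-¬Value₀-option _ (high→low {u' = u'} _ h e _) _ = x+k≢0 u' h (sym e)
[0,v]-¬Value₀-option _ (high→low-overtaking _ h _ refl) ([0,v] _) = n≮0 h
[0,v]-¬Value₀-option E (high→low-overtaking j h e refl) ([u,0] E') =
  Even-ν₂-¬double E (trans e (+-identityʳ (2 * j))) h E'
[0,v]-¬Value₀-option {v} _ (high→low-undercutting j h e _) _ =
  x+k≢0 v (1≤2*k h) (m+n≡0⇒m≡0 (v + 2 * j) (sym e))

Value₀-independent : ∀ {w w'} → Value₀ w → w ⇒ w' → ¬ Value₀ w'
Value₀-independent ([0,v] E) mv = [0,v]-¬Value₀-option E mv
Value₀-independent ([u,0] E) mv P = [0,v]-¬Value₀-option E (⇒-swap mv) (Value₀-swap P)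

Value₀-dominating : ∀ w → Value₀ w ⊎ Reaches Value₀ w
Value₀-dominating = by-symmetry _ (Sum.map Value₀-swap (Reaches-swap Value₀-swap)) dominating-≤
  where
  dominating-≤ : ∀ {u v} → u ≤ v → Value₀ (u , v) ⊎ Reaches Value₀ (u , v)
  dominating-≤ {zero} {v} _ with Even-ν₂-dichotomy v
  ... | inj₁ E = inj₁ ([0,v] E)
  ... | inj₂ (m , h , refl , E) = inj₂ ((m , 0) , high→mid m h refl refl , [u,0] E)
  dominating-≤ {suc u} u≤v with m≤n⇒∃[o]m+o≡n u≤v
  ... | d , refl with Even-ν₂-dichotomy d
  ...   | inj₁ E = inj₂ ((0 , d) , high→low (suc u) (s≤s z≤n) refl (+-comm (suc u) d) , [0,v] E)
  ...   | inj₂ (m , h , refl , E) =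
    inj₂ ((m , 0) , high→low-overtaking m h (sym (+-identityʳ _)) refl , [u,0] E)

-- Value 1 in the gap game

summand≤ : ∀ {n} x {k} → n ≡ x + k → k ≤ n
summand≤ x {k} e = subst (k ≤_) (sym e) (m≤n+m k x)

-- The indices are equations, so that matching on a Value₁ never has to unify
-- 4 * k + 2 with a numeral.
data Value₁ : Gaps → Set where
  [0,4k+2] : ∀ {u v} k → u ≡ 0 → v ≡ 4 * k + 2 → Value₁ (u , v)
  [4k+2,0] : ∀ {u v} k → u ≡ 4 * k + 2 → v ≡ 0 → Value₁ (u , v)
  [1,1]    : ∀ {u v} → u ≡ 1 → v ≡ 1 → Value₁ (u , v)
  [2,4k+3] : ∀ {u v} k → u ≡ 2 → v ≡ 4 * k + 3 → Value₁ (u , v)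
  [4k+3,2] : ∀ {u v} k → u ≡ 4 * k + 3 → v ≡ 2 → Value₁ (u , v)

Value₁-swap : ∀ {w} → Value₁ w → Value₁ (swap w)
Value₁-swap ([0,4k+2] k e e') = [4k+2,0] k e' e
Value₁-swap ([4k+2,0] k e e') = [0,4k+2] k e' e
Value₁-swap ([1,1] e e') = [1,1] e' e
Value₁-swap ([2,4k+3] k e e') = [4k+3,2] k e' e
Value₁-swap ([4k+3,2] k e e') = [2,4k+3] k e' e

Value₁-reaches-Value₀ : ∀ {w} → Value₁ w → Reaches Value₀ w
Value₁-reaches-Value₀ ([0,4k+2] k refl refl) =
  (2 * k + 1 , 0) , high→mid (2 * k + 1) (m≤n+m 1 (2 * k)) (solve (k ∷ [])) refl , [u,0] (ν₂-odd k)
Value₁-reaches-Value₀ ([4k+2,0] k refl refl) =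
  (0 , 2 * k + 1) , mid→low (2 * k + 1) (m≤n+m 1 (2 * k)) (solve (k ∷ [])) refl , [0,v] (ν₂-odd k)
Value₁-reaches-Value₀ ([1,1] refl refl) = (0 , 0) , high→low 1 (s≤s z≤n) refl refl , [0,v] ν₂-zero
Value₁-reaches-Value₀ ([2,4k+3] k refl refl) =
  (0 , 2 * (2 * k) + 1) , high→low 2 (s≤s z≤n) refl (solve (k ∷ [])) , [0,v] (ν₂-odd (2 * k))
Value₁-reaches-Value₀ ([4k+3,2] k refl refl) =
  (2 * (2 * k) + 1 , 0) , high→low 2 (s≤s z≤n) (solve (k ∷ [])) refl , [u,0] (ν₂-odd (2 * k))

¬Value₁[0,0] : ¬ Value₁ (0 , 0)
¬Value₁[0,0] ([0,4k+2] k _ e) = x+k≢0 (4 * k) (s≤s z≤n) (sym e)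
¬Value₁[0,0] ([4k+2,0] k e _) = x+k≢0 (4 * k) (s≤s z≤n) (sym e)
¬Value₁[0,0] ([4k+3,2] k e _) = x+k≢0 (4 * k) (s≤s z≤n) (sym e)

¬Value₁[j,4k+2∸2j] : ∀ {k j v'} → 1 ≤ j → 4 * k + 2 ≡ v' + 2 * j → ¬ Value₁ (j , v')
¬Value₁[j,4k+2∸2j] h _ ([0,4k+2] _ refl _) = n≮0 h
¬Value₁[j,4k+2∸2j] {k} _ e ([4k+2,0] t refl refl) =
  mod-clash 4 k (2 * t + 1) (λ ()) refl (trans e (solve (t ∷ [])))
¬Value₁[j,4k+2∸2j] {k} _ e ([1,1] refl refl) = mod-clash 4 k 0 (λ ()) refl e
¬Value₁[j,4k+2∸2j] {k} _ e ([2,4k+3] t refl refl) =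
  mod-clash 4 k (t + 1) (λ ()) refl (trans e (solve (t ∷ [])))
¬Value₁[j,4k+2∸2j] {k} _ e ([4k+3,2] t refl refl) =
  mod-clash 4 k (2 * t + 2) (λ ()) refl (trans e (solve (t ∷ [])))

[0,4k+2]-¬Value₁-option : ∀ {k w'} → (0 , 4 * k + 2) ⇒ w' → ¬ Value₁ w'
[0,4k+2]-¬Value₁-option (mid→low {u' = u'} _ h e _) _ = x+k≢0 u' (1≤2*k h) (sym e)
[0,4k+2]-¬Value₁-option {k} (high→mid _ h e refl) = ¬Value₁[j,4k+2∸2j] {k} h e
[0,4k+2]-¬Value₁-option (high→low {u' = u'} _ h e _) _ = x+k≢0 u' h (sym e)
[0,4k+2]-¬Value₁-option {k} (high→low-overtaking {v' = v'} j h e refl) =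
  ¬Value₁[j,4k+2∸2j] {k} h (trans e (+-comm (2 * j) v'))
[0,4k+2]-¬Value₁-option {k} (high→low-undercutting j h e _) _ =
  x+k≢0 (4 * k + 2) (1≤2*k h) (m+n≡0⇒m≡0 (4 * k + 2 + 2 * j) (sym e))

1≡x+k⇒x≡0 : ∀ {x k} → 1 ≤ k → 1 ≡ x + k → x ≡ 0
1≡x+k⇒x≡0 {x} {suc k} _ e = m+n≡0⇒m≡0 x (sym (suc-injective (trans e (+-suc x k))))

[1,1]-¬Value₁-option : ∀ {w'} → (1 , 1) ⇒ w' → ¬ Value₁ w'
[1,1]-¬Value₁-option (mid→low {u' = u'} _ h e _) _ = n≮n 1 (≤-trans (*-monoʳ-≤ 2 h) (summand≤ u' e))
[1,1]-¬Value₁-option (high→mid {v' = v'} _ h e _) _ = n≮n 1 (≤-trans (*-monoʳ-≤ 2 h) (summand≤ v' e))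
[1,1]-¬Value₁-option (high→low _ h e e') A
  rewrite 1≡x+k⇒x≡0 h e | 1≡x+k⇒x≡0 h e' = ¬Value₁[0,0] A
[1,1]-¬Value₁-option (high→low-overtaking (suc _) _ () _)
[1,1]-¬Value₁-option (high→low-undercutting (suc _) _ () _)

2≡x+2j⇒x≡0×j≡1 : ∀ {x j} → 1 ≤ j → 2 ≡ x + 2 * j → x ≡ 0 × j ≡ 1
2≡x+2j⇒x≡0×j≡1 {x} {suc zero} _ e = +-cancelʳ-≡ 2 x 0 (sym e) , refl
2≡x+2j⇒x≡0×j≡1 {x} {suc (suc j)} _ e with summand≤ x e
... | s≤s (s≤s le) = ⊥-elim (m+1+n≢0 j (n≤0⇒n≡0 le))

¬Value₁[0,4k+4] : ∀ {k v'} → v' ≡ 4 * k + 3 + 1 → ¬ Value₁ (0 , v')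
¬Value₁[0,4k+4] {k} e ([0,4k+2] t _ e') = mod-clash 4 t (k + 1) {2} {0} (λ ()) (trans (sym e) e') (solve (k ∷ []))
¬Value₁[0,4k+4] {k} e ([4k+2,0] t _ e') = x+k≢0 (4 * k + 3) (s≤s z≤n) (trans (sym e) e')
¬Value₁[0,4k+4] _ ([4k+3,2] t e' _) = x+k≢0 (4 * t) (s≤s z≤n) (sym e')

¬Value₁[1,4k+2] : ∀ {k} → ¬ Value₁ (1 , 4 * k + 2)
¬Value₁[1,4k+2] ([4k+2,0] t e _) = mod-clash 4 0 t (λ ()) refl e
¬Value₁[1,4k+2] {k} ([1,1] _ e) = mod-clash 4 k 0 (λ ()) refl e
¬Value₁[1,4k+2] ([4k+3,2] t e _) = mod-clash 4 0 t (λ ()) refl e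

¬Value₁[0,4k+1] : ∀ {k} → ¬ Value₁ (0 , 4 * k + 1)
¬Value₁[0,4k+1] {k} ([0,4k+2] t _ e) = mod-clash 4 k t (λ ()) refl e
¬Value₁[0,4k+1] ([4k+2,0] t e _) = x+k≢0 (4 * t) (s≤s z≤n) (sym e)
¬Value₁[0,4k+1] ([4k+3,2] t e _) = x+k≢0 (4 * t) (s≤s z≤n) (sym e)

[2,4k+3]-high→low-¬Value₁ : ∀ {k j u' v'} → 1 ≤ j → 2 ≡ u' + j → 4 * k + 3 ≡ v' + j → ¬ Value₁ (u' , v')
[2,4k+3]-high→low-¬Value₁ {k} {1} {u'} {v'} _ e e'
  rewrite +-cancelʳ-≡ 1 u' 1 (sym e) | +-cancelʳ-≡ 1 v' (4 * k + 2) (trans (sym e') (solve (k ∷ []))) =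
  ¬Value₁[1,4k+2] {k}
[2,4k+3]-high→low-¬Value₁ {k} {2} {u'} {v'} _ e e'
  rewrite +-cancelʳ-≡ 2 u' 0 (sym e) | +-cancelʳ-≡ 2 v' (4 * k + 1) (trans (sym e') (solve (k ∷ []))) =
  ¬Value₁[0,4k+1] {k}
[2,4k+3]-high→low-¬Value₁ {j = suc (suc (suc j))} {u'} _ e _ with summand≤ u' e
... | s≤s (s≤s ())

[2,4k+3]-¬Value₁-option : ∀ {k w'} → (2 , 4 * k + 3) ⇒ w' → ¬ Value₁ w'
[2,4k+3]-¬Value₁-option {k} (mid→low {u' = u'} j h e e') with 2≡x+2j⇒x≡0×j≡1 {u'} {j} h e
... | refl , refl = ¬Value₁[0,4k+4] {k} e'
[2,4k+3]-¬Value₁-option (high→mid _ _ _ refl) ([0,4k+2] _ () _)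
[2,4k+3]-¬Value₁-option {k} (high→mid j _ e refl) ([4k+2,0] _ _ refl) =
  mod-clash 2 j (2 * k + 1) (λ ()) (trans e (sym (+-identityʳ (2 * j)))) (solve (k ∷ []))
[2,4k+3]-¬Value₁-option (high→mid _ _ _ refl) ([1,1] () _)
[2,4k+3]-¬Value₁-option (high→mid j h _ refl) ([2,4k+3] _ e' _) = n≮0 (subst (1 ≤_) (+-cancelˡ-≡ 2 j 0 e') h)
[2,4k+3]-¬Value₁-option {k} (high→mid j _ e refl) ([4k+3,2] _ _ refl) =
  mod-clash 2 (j + 1) (2 * k + 1) {0} (λ ()) (trans e (solve (j ∷ []))) (solve (k ∷ []))
[2,4k+3]-¬Value₁-option {k} (high→low _ h e e') = [2,4k+3]-high→low-¬Value₁ {k} h e e'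
[2,4k+3]-¬Value₁-option (high→low-overtaking _ h _ refl) ([0,4k+2] _ refl _) = n≮0 h
[2,4k+3]-¬Value₁-option {k} (high→low-overtaking j _ e refl) ([4k+2,0] _ _ refl) =
  mod-clash 2 (j + 1) (2 * k + 1) {0} (λ ()) (trans e (solve (j ∷ []))) (solve (k ∷ []))
[2,4k+3]-¬Value₁-option {k} (high→low-overtaking _ _ e refl) ([1,1] refl refl) =
  mod-clash 4 k 1 (λ ()) refl e
[2,4k+3]-¬Value₁-option {k} (high→low-overtaking _ _ e refl) ([2,4k+3] t refl refl) =
  mod-clash 4 k (t + 2) (λ ()) refl (trans e (solve (t ∷ [])))
[2,4k+3]-¬Value₁-option {k} (high→low-overtaking j _ e refl) ([4k+3,2] _ _ refl) =
  mod-clash 2 (j + 2) (2 * k + 1) {0} (λ ()) (trans e (solve (j ∷ []))) (solve (k ∷ []))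
[2,4k+3]-¬Value₁-option {k} (high→low-undercutting {u' = u'} j _ e _) _ =
  n≮n 2 (≤-trans (m≤n+m 3 (4 * k)) (≤-trans (m≤m+n (4 * k + 3) (2 * j)) (≤-trans (m≤m+n _ u') (≤-reflexive (sym e)))))

Value₁-independent : ∀ {w w'} → Value₁ w → w ⇒ w' → ¬ Value₁ w'
Value₁-independent ([0,4k+2] k refl refl) = [0,4k+2]-¬Value₁-option {k}
Value₁-independent ([4k+2,0] k refl refl) mv A = [0,4k+2]-¬Value₁-option {k} (⇒-swap mv) (Value₁-swap A)
Value₁-independent ([1,1] refl refl) = [1,1]-¬Value₁-option
Value₁-independent ([2,4k+3] k refl refl) = [2,4k+3]-¬Value₁-option {k}
Value₁-independent ([4k+3,2] k refl refl) mv A = [2,4k+3]-¬Value₁-option {k} (⇒-swap mv) (Value₁-swap A)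

Value₁-dominated : Gaps → Set
Value₁-dominated w = Value₁ w ⊎ Value₀ w ⊎ Reaches Value₁ w

[0,v]-Value₁-dominated : ∀ v → Value₁-dominated (0 , v)
[0,v]-Value₁-dominated v with halve v
... | odd q = inj₂ (inj₁ ([0,v] (ν₂-odd q)))
... | even q with halve q
...   | odd r = inj₁ ([0,4k+2] r refl (solve (r ∷ [])))
...   | even r with halve r
...     | odd s = inj₂ (inj₁ ([0,v] (ν₂-×4 (m≤n+m 1 (2 * s)) (ν₂-odd s))))
...     | even zero = inj₂ (inj₁ ([0,v] ν₂-zero))
...     | even (suc t) = inj₂ (inj₂ ((4 * t + 3 , 2) ,
  high→mid (4 * t + 3) (m≤n⇒m≤o+n (4 * t) (s≤s z≤n)) (solve (t ∷ [])) refl , [4k+3,2] t refl refl))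

odd-difference-Value₁-dominated : ∀ u q → Value₁-dominated (suc u , suc u + (2 * q + 1))
odd-difference-Value₁-dominated u q with halve q
odd-difference-Value₁-dominated zero _ | even r with halve r
... | even s = inj₂ (inj₂ ((4 * s + 2 , 0) ,
  high→mid (4 * s + 1) (m≤n+m 1 (4 * s)) (solve (s ∷ [])) (solve (s ∷ [])) , [4k+2,0] s refl refl))
... | odd s = inj₂ (inj₂ ((4 * s + 3 , 2) ,
  high→mid (4 * s + 2) (m≤n⇒m≤o+n (4 * s) (s≤s z≤n)) (solve (s ∷ [])) (solve (s ∷ [])) , [4k+3,2] s refl refl))
odd-difference-Value₁-dominated (suc zero) _ | even r = inj₁ ([2,4k+3] r refl (solve (r ∷ [])))
odd-difference-Value₁-dominated (suc (suc u)) _ | even r = inj₂ (inj₂ ((2 , 4 * r + 3) ,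
  high→low (suc u) (s≤s z≤n) refl (solve (u ∷ r ∷ [])) , [2,4k+3] r refl refl))
odd-difference-Value₁-dominated u _ | odd zero = inj₂ (inj₂ ((1 , 1) ,
  high→low-overtaking 1 (s≤s z≤n) (solve (u ∷ [])) refl , [1,1] refl refl))
odd-difference-Value₁-dominated u _ | odd (suc r) = inj₂ (inj₂ ((2 , 4 * r + 3) ,
  high→low-overtaking 2 (s≤s z≤n) (solve (u ∷ r ∷ [])) refl , [2,4k+3] r refl refl))

even-difference-Value₁-dominated : ∀ u q → Value₁-dominated (suc u , suc u + 2 * q)
even-difference-Value₁-dominated u q with halve q
... | odd r = inj₂ (inj₂ ((0 , 4 * r + 2) ,
  high→low (suc u) (s≤s z≤n) refl (solve (u ∷ r ∷ [])) , [0,4k+2] r refl refl))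
... | even r with halve r
...   | odd s = inj₂ (inj₂ ((4 * s + 2 , 0) ,
  high→low-overtaking (4 * s + 2) (m≤n⇒m≤o+n (4 * s) (s≤s z≤n)) (solve (u ∷ s ∷ [])) refl , [4k+2,0] s refl refl))
...   | even (suc t) = inj₂ (inj₂ ((4 * t + 3 , 2) ,
  high→low-overtaking (4 * t + 3) (m≤n⇒m≤o+n (4 * t) (s≤s z≤n)) (solve (u ∷ t ∷ [])) refl , [4k+3,2] t refl refl))
even-difference-Value₁-dominated zero _ | even _ | even zero = inj₁ ([1,1] refl refl)
even-difference-Value₁-dominated (suc u) _ | even _ | even zero = inj₂ (inj₂ ((1 , 1) ,
  high→low (suc u) (s≤s z≤n) refl (solve (u ∷ [])) , [1,1] refl refl))

Value₁-dominating : ∀ w → Value₁-dominated w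
Value₁-dominating = by-symmetry _ (Sum.map Value₁-swap (Sum.map Value₀-swap (Reaches-swap Value₁-swap))) dominated-≤
  where
  dominated-≤ : ∀ {u v} → u ≤ v → Value₁-dominated (u , v)
  dominated-≤ {zero} {v} _ = [0,v]-Value₁-dominated v
  dominated-≤ {suc u} u≤v with m≤n⇒∃[o]m+o≡n u≤v
  ... | d , refl with halve d
  ...   | odd q = odd-difference-Value₁-dominated u q
  ...   | even q = even-difference-Value₁-dominated u q

-- From positions to gaps

swap₁₂ swap₂₃ : Pos → Pos
swap₁₂ (x , y , z) = y , x , z
swap₂₃ (x , y , z) = x , z , y

⟶-swap₁₂ : ∀ {p q} → p ⟶ q → swap₁₂ p ⟶ swap₁₂ q
⟶-swap₁₂ (mv21 h h') = mv12 h h'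
⟶-swap₁₂ (mv31 h h') = mv32 h h'
⟶-swap₁₂ (mv12 h h') = mv21 h h'
⟶-swap₁₂ (mv32 h h') = mv31 h h'
⟶-swap₁₂ (mv13 h h') = mv23 h h'
⟶-swap₁₂ (mv23 h h') = mv13 h h'

⟶-swap₂₃ : ∀ {p q} → p ⟶ q → swap₂₃ p ⟶ swap₂₃ q
⟶-swap₂₃ (mv21 h h') = mv31 h h'
⟶-swap₂₃ (mv31 h h') = mv21 h h'
⟶-swap₂₃ (mv12 h h') = mv13 h h'
⟶-swap₂₃ (mv13 h h') = mv12 h h'
⟶-swap₂₃ (mv32 h h') = mv23 h h'
⟶-swap₂₃ (mv23 h h') = mv32 h h'

infix 4 _∼_
data _∼_ : Pos → Pos → Set where
  ∼-refl   : ∀ {p} → p ∼ p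
  ∼-swap₁₂ : ∀ {p q} → p ∼ q → p ∼ swap₁₂ q
  ∼-swap₂₃ : ∀ {p q} → p ∼ q → p ∼ swap₂₃ q

⟶-∼ : ∀ {p p' q} → p ∼ p' → p ⟶ q → ∃[ q' ] (p' ⟶ q' × q ∼ q')
⟶-∼ ∼-refl mv = _ , mv , ∼-refl
⟶-∼ (∼-swap₁₂ r) mv with ⟶-∼ r mv
... | q' , mv' , r' = swap₁₂ q' , ⟶-swap₁₂ mv' , ∼-swap₁₂ r'
⟶-∼ (∼-swap₂₃ r) mv with ⟶-∼ r mv
... | q' , mv' , r' = swap₂₃ q' , ⟶-swap₂₃ mv' , ∼-swap₂₃ r'

-- The swaps are involutions up to η, which is what makes these recursive calls typecheck.
⟶-∼⁻ : ∀ {p p' q'} → p ∼ p' → p' ⟶ q' → ∃[ q ] (p ⟶ q × q ∼ q')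
⟶-∼⁻ ∼-refl mv = _ , mv , ∼-refl
⟶-∼⁻ (∼-swap₁₂ r) mv with ⟶-∼⁻ r (⟶-swap₁₂ mv)
... | q , mv' , r' = q , mv' , ∼-swap₁₂ r'
⟶-∼⁻ (∼-swap₂₃ r) mv with ⟶-∼⁻ r (⟶-swap₂₃ mv)
... | q , mv' , r' = q , mv' , ∼-swap₂₃ r'

Sorted : Pos → Set
Sorted (x , y , z) = x ≤ y × y ≤ z

sort : ∀ p → ∃[ p' ] (p ∼ p' × Sorted p')
sort (x , y , z) with ≤-total x y | ≤-total y z | ≤-total x z
... | inj₁ xy | inj₁ yz | _       = _ , ∼-refl , xy , yz
... | inj₁ xy | inj₂ zy | inj₁ xz = _ , ∼-swap₂₃ ∼-refl , xz , zy
... | inj₁ xy | inj₂ zy | inj₂ zx = _ , ∼-swap₁₂ (∼-swap₂₃ ∼-refl) , zx , xy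
... | inj₂ yx | inj₁ yz | inj₁ xz = _ , ∼-swap₁₂ ∼-refl , yx , xz
... | inj₂ yx | inj₁ yz | inj₂ zx = _ , ∼-swap₂₃ (∼-swap₁₂ ∼-refl) , yz , zx
... | inj₂ yx | inj₂ zy | _       = _ , ∼-swap₁₂ (∼-swap₂₃ (∼-swap₁₂ ∼-refl)) , zy , yx

-- Opaque, so that unification solves gaps ?p = gaps q by ?p := q.
opaque
  spread : (low high total : ℕ) → Gaps
  spread low high total = mid ∸ low , high ∸ mid
    where
    mid : ℕ
    mid = total ∸ low ∸ high

  gaps : Pos → Gaps
  gaps (x , y , z) = spread (x ⊓ y ⊓ z) (x ⊔ y ⊔ z) (x + y + z)

  gaps-swap₁₂ : ∀ p → gaps (swap₁₂ p) ≡ gaps p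
  gaps-swap₁₂ (x , y , z) rewrite ⊓-comm y x | ⊔-comm y x | +-comm y x = refl

  gaps-swap₂₃ : ∀ p → gaps (swap₂₃ p) ≡ gaps p
  gaps-swap₂₃ (x , y , z)
    rewrite ⊓-assoc x z y | ⊓-comm z y | sym (⊓-assoc x y z)
          | ⊔-assoc x z y | ⊔-comm z y | sym (⊔-assoc x y z)
          | +-assoc x z y | +-comm z y | sym (+-assoc x y z) = refl

  gaps-of : ∀ a {u v y z} → y ≡ a + u → z ≡ a + u + v → gaps (a , y , z) ≡ (u , v)
  gaps-of a {u} {v} refl refl = begin
      spread (a ⊓ (a + u) ⊓ (a + u + v)) (a ⊔ (a + u) ⊔ (a + u + v)) (a + (a + u) + (a + u + v))
    ≡⟨ cong₂ (λ low high → spread low high (a + (a + u) + (a + u + v))) low≡a high≡a+u+v ⟩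
      spread a (a + u + v) (a + (a + u) + (a + u + v))
    ≡⟨ cong₂ _,_ (trans (cong (_∸ a) mid≡a+u) (m+n∸m≡n a u)) (trans (cong (a + u + v ∸_) mid≡a+u) (m+n∸m≡n (a + u) v)) ⟩
      (u , v)
    ∎
    where
    open ≡-Reasoning
    a≤a+u : a ≤ a + u
    a≤a+u = m≤m+n a u
    a+u≤a+u+v : a + u ≤ a + u + v
    a+u≤a+u+v = m≤m+n (a + u) v
    low≡a : a ⊓ (a + u) ⊓ (a + u + v) ≡ a
    low≡a = trans (cong (_⊓ (a + u + v)) (m≤n⇒m⊓n≡m a≤a+u)) (m≤n⇒m⊓n≡m (≤-trans a≤a+u a+u≤a+u+v))
    high≡a+u+v : a ⊔ (a + u) ⊔ (a + u + v) ≡ a + u + v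
    high≡a+u+v = trans (cong (_⊔ (a + u + v)) (m≤n⇒m⊔n≡n a≤a+u)) (m≤n⇒m⊔n≡n a+u≤a+u+v)
    mid≡a+u : a + (a + u) + (a + u + v) ∸ a ∸ (a + u + v) ≡ a + u
    mid≡a+u = begin
        a + (a + u) + (a + u + v) ∸ a ∸ (a + u + v)
      ≡⟨ cong (λ n → n ∸ a ∸ (a + u + v)) (+-assoc a (a + u) (a + u + v)) ⟩
        a + ((a + u) + (a + u + v)) ∸ a ∸ (a + u + v)
      ≡⟨ cong (_∸ (a + u + v)) (m+n∸m≡n a _) ⟩
        (a + u) + (a + u + v) ∸ (a + u + v)
      ≡⟨ m+n∸n≡m (a + u) (a + u + v) ⟩
        a + u
      ∎

gaps-∼ : ∀ {p q} → p ∼ q → gaps p ≡ gaps q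
gaps-∼ ∼-refl = refl
gaps-∼ (∼-swap₁₂ {q = q} r) = trans (gaps-∼ r) (sym (gaps-swap₁₂ q))
gaps-∼ (∼-swap₂₃ {q = q} r) = trans (gaps-∼ r) (sym (gaps-swap₂₃ q))

gaps-⇒ : ∀ {p q w w'} → w ⇒ w' → gaps p ≡ w → gaps q ≡ w' → gaps p ⇒ gaps q
gaps-⇒ mv refl refl = mv

x+k≰x : ∀ x {k} → 1 ≤ k → ¬ x + k ≤ x
x+k≰x x h = <⇒≱ (m<m+n x h)

project-high→low : ∀ {a u x k} → 1 ≤ k → a + u ≤ a + k + x + k →
                   gaps (a , a + u , a + k + x + k) ⇒ gaps (a + k , a + u , a + k + x)
project-high→low {a} {u} {x} {k} h s₂ with k ≤? u
... | yes k≤u with m≤n⇒∃[o]m+o≡n k≤u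
...   | u' , refl with u' ≤? x
...     | yes u'≤x with m≤n⇒∃[o]m+o≡n u'≤x
...       | y , refl = gaps-⇒ (high→low {u' = u'} {v' = y} k h (+-comm k u') refl)
  (gaps-of a refl (solve (a ∷ k ∷ u' ∷ y ∷ [])))
  (gaps-of (a + k) (solve (a ∷ k ∷ u' ∷ [])) (solve (a ∷ k ∷ u' ∷ y ∷ [])))
project-high→low {a} {u} {x} {k} h s₂ | yes _ | u' , refl | no u'≰x with m≤n⇒∃[o]m+o≡n (≰⇒> u'≰x)
... | y , refl with m≤n⇒∃[o]m+o≡n s₂
...   | v , top = gaps-⇒ (high→low-undercutting {v = v} {u' = x} (suc y) (s≤s z≤n) source≡ refl)
  (gaps-of a refl (sym top))
  (trans (sym (gaps-swap₂₃ _)) (gaps-of (a + k) refl (solve (a ∷ k ∷ x ∷ y ∷ []))))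
  where
  k≡ : suc y + v ≡ k
  k≡ = +-cancelˡ-≡ (a + k + x) (suc y + v) k (sym (trans (sym top) (solve (a ∷ k ∷ x ∷ y ∷ v ∷ []))))
  source≡ : k + (suc x + y) ≡ v + 2 * suc y + x
  source≡ = trans (cong (_+ (suc x + y)) (sym k≡)) (solve (x ∷ y ∷ v ∷ []))
project-high→low {a} {u} {x} {k} h s₂ | no k≰u with m≤n⇒∃[o]m+o≡n (≰⇒> k≰u)
... | w , refl = gaps-⇒ (high→low-overtaking {u = u} {v' = x} (suc w) (s≤s z≤n) refl refl)
  (gaps-of a refl (solve (a ∷ u ∷ w ∷ x ∷ [])))
  (trans (sym (gaps-swap₁₂ _)) (gaps-of (a + u) (solve (a ∷ u ∷ w ∷ [])) (solve (a ∷ u ∷ w ∷ x ∷ []))))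

project-sorted : ∀ {p q} → Sorted p → p ⟶ q → gaps p ⇒ gaps q
project-sorted (_ , s₂) (mv21 {a} {k = k} h h') with m≤n⇒∃[o]m+o≡n h'
... | s , refl with m≤n⇒∃[o]m+o≡n s₂
... | t , refl = gaps-⇒ (mid→low {v = t} {u' = s} k h refl refl)
  (gaps-of a (solve (a ∷ k ∷ s ∷ [])) (solve (a ∷ k ∷ s ∷ t ∷ [])))
  (gaps-of (a + k) refl (solve (a ∷ k ∷ s ∷ t ∷ [])))
project-sorted (s₁ , _) (mv32 {a} {k = k} h h') with m≤n⇒∃[o]m+o≡n s₁
... | u , refl with m≤n⇒∃[o]m+o≡n h'
... | t , refl = gaps-⇒ (high→mid {u = u} {v' = t} k h refl refl)
  (gaps-of a refl (solve (a ∷ u ∷ k ∷ t ∷ [])))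
  (gaps-of a (solve (a ∷ u ∷ k ∷ [])) (solve (a ∷ u ∷ k ∷ t ∷ [])))
project-sorted (s₁ , _) (mv12 {a} {b} {k = k} h h') = ⊥-elim (x+k≰x a h (≤-trans s₁ (≤-trans (m≤m+n b k) h')))
project-sorted (s₁ , s₂) (mv13 {a} {c = c} {k} h h') =
  ⊥-elim (x+k≰x c h (≤-trans h' (≤-trans (m≤m+n a k) (≤-trans s₁ s₂))))
project-sorted (_ , s₂) (mv23 {b = b} {c} {k} h h') = ⊥-elim (x+k≰x c h (≤-trans h' (≤-trans (m≤m+n b k) s₂)))
project-sorted (s₁ , s₂) (mv31 h h') with m≤n⇒∃[o]m+o≡n s₁ | m≤n⇒∃[o]m+o≡n h'
... | u , refl | x , refl = project-high→low h s₂

project : ∀ {p q} → p ⟶ q → gaps p ⇒ gaps q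
project {p} mv with sort p
... | p' , p∼p' , sorted with ⟶-∼ p∼p' mv
...   | q' , mv' , q∼q' = subst₂ _⇒_ (sym (gaps-∼ p∼p')) (sym (gaps-∼ q∼q')) (project-sorted sorted mv')

pos : ℕ → Gaps → Pos
pos a (u , v) = a , a + u , a + u + v

⟶-respˡ-≡ : ∀ {p p' q} → p' ⟶ q → p' ≡ p → p ⟶ q
⟶-respˡ-≡ mv refl = mv

triple-≡ : ∀ {x y z x' y' z' : ℕ} → x ≡ x' → y ≡ y' → z ≡ z' → (x , y , z) ≡ (x' , y' , z')
triple-≡ refl refl refl = refl

lift-sorted : ∀ a {w w'} → w ⇒ w' → ∃[ q ] (pos a w ⟶ q × gaps q ≡ w')
lift-sorted a (mid→low {v = v} {u' = u'} k h refl refl) =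
  _ , ⟶-respˡ-≡ (mv21 {a} {a + k + u'} {a + (u' + 2 * k) + v} h (m≤m+n (a + k) u'))
              (triple-≡ refl (solve (a ∷ k ∷ u' ∷ [])) refl) ,
  gaps-of (a + k) refl (solve (a ∷ k ∷ u' ∷ v ∷ []))
lift-sorted a (high→mid {u = u} {v' = v'} k h refl refl) =
  _ , ⟶-respˡ-≡ (mv32 {a} {a + u} {a + u + k + v'} h (m≤m+n (a + u + k) v'))
              (triple-≡ refl refl (solve (a ∷ u ∷ k ∷ v' ∷ []))) ,
  gaps-of a (solve (a ∷ u ∷ k ∷ [])) (solve (a ∷ u ∷ k ∷ v' ∷ []))
lift-sorted a (high→low {u' = u'} {v' = v'} k h refl refl) =
  _ , ⟶-respˡ-≡ (mv31 {a} {a + (u' + k)} {a + k + u' + v'} h (≤-trans (m≤m+n (a + k) u') (m≤m+n _ v')))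
              (triple-≡ refl refl (solve (a ∷ k ∷ u' ∷ v' ∷ []))) ,
  gaps-of (a + k) (solve (a ∷ u' ∷ k ∷ [])) refl
lift-sorted a (high→low-overtaking {u = u} {v' = v'} j h refl refl) =
  _ , ⟶-respˡ-≡ (mv31 {a} {a + u} {a + u + j + v'} {u + j} (m≤n⇒m≤o+n u h)
                  (≤-trans (≤-reflexive (sym (+-assoc a u j))) (m≤m+n _ v')))
              (triple-≡ refl refl (solve (a ∷ u ∷ j ∷ v' ∷ []))) ,
  trans (sym (gaps-swap₁₂ _)) (gaps-of (a + u) (solve (a ∷ u ∷ j ∷ [])) refl)
lift-sorted a (high→low-undercutting {v = v} {u' = u'} j h refl refl) =
  _ , ⟶-respˡ-≡ (mv31 {a} {a + (v + 2 * j + u')} {a + v + j + u'} {v + j} (m≤n⇒m≤o+n v h)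
                  (≤-trans (≤-reflexive (sym (+-assoc a v j))) (m≤m+n _ u')))
              (triple-≡ refl refl (solve (a ∷ v ∷ j ∷ u' ∷ []))) ,
  trans (sym (gaps-swap₂₃ _)) (gaps-of (a + (v + j)) (solve (a ∷ v ∷ j ∷ u' ∷ [])) (solve (a ∷ v ∷ j ∷ u' ∷ [])))

lift : ∀ {p w} → gaps p ⇒ w → ∃[ q ] (p ⟶ q × gaps q ≡ w)
lift {p} mv with sort p
... | (a , _ , _) , p∼p' , (s₁ , s₂) with m≤n⇒∃[o]m+o≡n s₁
...   | u , refl with m≤n⇒∃[o]m+o≡n s₂
...     | v , refl with lift-sorted a (subst (_⇒ _) (trans (gaps-∼ p∼p') (gaps-of a refl refl)) mv)
...       | q' , mv' , gaps-q' with ⟶-∼⁻ p∼p' mv'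
...         | q , mv'' , q∼q' = q , mv'' , trans (gaps-∼ q∼q') gaps-q'

-- Termination and Sprague–Grundy values

-- Opaque for the same reason as gaps.
opaque
  size : Pos → ℕ
  size (x , y , z) = x * x + y * y + z * z

  size-swap₁₂ : ∀ p → size (swap₁₂ p) ≡ size p
  size-swap₁₂ (x , y , z) = cong (_+ z * z) (+-comm (y * y) (x * x))

  size-swap₂₃ : ∀ p → size (swap₂₃ p) ≡ size p
  size-swap₂₃ (x , y , z) = xy∙z≈xz∙y (x * x) (z * z) (y * y)

  transfer₂₁-shrinks : ∀ a b c k → 1 ≤ k → a + k ≤ b → size (a + k , b , c) < size (a , b + k , c)
  transfer₂₁-shrinks a _ c (suc k) _ a+k≤b with m≤n⇒∃[o]m+o≡n a+k≤b
  ... | t , refl = +-monoˡ-< (c * c) (<-≤-trans (m<m+n _ 0<2k[k+t]) (≤-reflexive (expand a k t)))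
    where
    0<2k[k+t] : 0 < 2 * suc k * (suc k + t)
    0<2k[k+t] = >-nonZero⁻¹ _ {{m*n≢0 (2 * suc k) (suc k + t)}}
    expand : ∀ a k t → (a + suc k) * (a + suc k) + (a + suc k + t) * (a + suc k + t) + 2 * suc k * (suc k + t)
                       ≡ a * a + (a + suc k + t + suc k) * (a + suc k + t + suc k)
    expand = solve-∀

size-∼ : ∀ {p q} → p ∼ q → size p ≡ size q
size-∼ ∼-refl = refl
size-∼ (∼-swap₁₂ {q = q} r) = trans (size-∼ r) (sym (size-swap₁₂ q))
size-∼ (∼-swap₂₃ {q = q} r) = trans (size-∼ r) (sym (size-swap₂₃ q))

-- Every move is a transfer from pile 2 to pile 1 after relabelling the piles.
size-decreasing : ∀ {p q} → p ⟶ q → size q < size p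
size-decreasing (mv21 {a} {b} {c} {k} h h') = transfer₂₁-shrinks a b c k h h'
size-decreasing (mv12 {a} {b} {c} {k} h h') =
  subst₂ _<_ (size-∼ (∼-swap₁₂ ∼-refl)) (size-∼ (∼-swap₁₂ ∼-refl)) (transfer₂₁-shrinks b a c k h h')
size-decreasing (mv31 {a} {b} {c} {k} h h') =
  subst₂ _<_ (size-∼ (∼-swap₂₃ ∼-refl)) (size-∼ (∼-swap₂₃ ∼-refl)) (transfer₂₁-shrinks a c b k h h')
size-decreasing (mv13 {a} {b} {c} {k} h h') =
  subst₂ _<_ (size-∼ (∼-swap₂₃ (∼-swap₁₂ ∼-refl))) (size-∼ (∼-swap₂₃ (∼-swap₁₂ ∼-refl))) (transfer₂₁-shrinks c a b k h h')
size-decreasing (mv32 {a} {b} {c} {k} h h') =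
  subst₂ _<_ (size-∼ (∼-swap₁₂ (∼-swap₂₃ ∼-refl))) (size-∼ (∼-swap₁₂ (∼-swap₂₃ ∼-refl))) (transfer₂₁-shrinks b c a k h h')
size-decreasing (mv23 {a} {b} {c} {k} h h') =
  subst₂ _<_ (size-∼ (∼-swap₁₂ (∼-swap₂₃ (∼-swap₁₂ ∼-refl)))) (size-∼ (∼-swap₁₂ (∼-swap₂₃ (∼-swap₁₂ ∼-refl))))
    (transfer₂₁-shrinks c b a k h h')

⟶-induction : (P : Pos → Set) → (∀ p → (∀ {q} → p ⟶ q → P q) → P p) → ∀ p → P p
⟶-induction P step p = go p (<-wellFounded (size p))
  where
  go : ∀ p → Acc _<_ (size p) → P p
  go p (acc rs) = step p (λ mv → go _ (rs (size-decreasing mv)))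

transfers₂₁ : Pos → List Pos
transfers₂₁ (a , b , c) = map (λ k → a + k , b ∸ k , c) (filter (λ k → a + k ≤? b ∸ k) (map suc (upTo b)))

transfers₂₁-sound : ∀ {p q} → q ∈ transfers₂₁ p → p ⟶ q
transfers₂₁-sound {a , b , c} q∈ with ∈-map⁻ _ q∈
... | k , k∈ , refl with ∈-filter⁻ (λ k → a + k ≤? b ∸ k) {xs = map suc (upTo b)} k∈
...   | k∈' , fits with ∈-map⁻ suc k∈'
...     | i , i∈ , refl =
  ⟶-respˡ-≡ (mv21 {a} {b ∸ suc i} {c} (s≤s z≤n) fits) (triple-≡ refl (m∸n+n≡m (∈-upTo⁻ i∈)) refl)

transfers₂₁-complete : ∀ {a b c k} → 1 ≤ k → a + k ≤ b → (a + k , b , c) ∈ transfers₂₁ (a , b + k , c)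
transfers₂₁-complete {a} {b} {c} {suc i} _ a+k≤b =
  subst (λ b' → (a + suc i , b' , c) ∈ transfers₂₁ (a , b + suc i , c)) (m+n∸n≡m b (suc i))
    (∈-map⁺ _ (∈-filter⁺ (λ k → a + k ≤? b + suc i ∸ k) (∈-map⁺ suc (∈-upTo⁺ (m≤n+m (suc i) b)))
                          (subst (a + suc i ≤_) (sym (m+n∸n≡m b (suc i))) a+k≤b)))

transfers-via : (σ σ⁻¹ : Pos → Pos) → Pos → List Pos
transfers-via σ σ⁻¹ p = map σ⁻¹ (transfers₂₁ (σ p))

transfers-via-sound : ∀ σ σ⁻¹ → (∀ {p q} → p ⟶ q → σ⁻¹ p ⟶ σ⁻¹ q) → (∀ p → σ⁻¹ (σ p) ≡ p) →
                      ∀ {p q} → q ∈ transfers-via σ σ⁻¹ p → p ⟶ q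
transfers-via-sound σ σ⁻¹ σ⁻¹-⟶ σ⁻¹∘σ {p} q∈ with ∈-map⁻ σ⁻¹ q∈
... | q' , q'∈ , refl = subst (_⟶ σ⁻¹ q') (σ⁻¹∘σ p) (σ⁻¹-⟶ (transfers₂₁-sound q'∈))

rotate rotate⁻¹ swap₁₃ : Pos → Pos
rotate = swap₁₂ ∘ swap₂₃
rotate⁻¹ = swap₂₃ ∘ swap₁₂
swap₁₃ = swap₁₂ ∘ swap₂₃ ∘ swap₁₂

move-lists : Pos → List (List Pos)
move-lists p = transfers-via id id p ∷ transfers-via swap₁₂ swap₁₂ p ∷ transfers-via swap₂₃ swap₂₃ p ∷
               transfers-via rotate rotate⁻¹ p ∷ transfers-via rotate⁻¹ rotate p ∷ transfers-via swap₁₃ swap₁₃ p ∷ []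

options : Pos → List Pos
options p = concat (move-lists p)

options-sound : ∀ {p q} → q ∈ options p → p ⟶ q
options-sound {p} q∈ with ∈-concat⁻′ (move-lists p) q∈
... | _ , q∈xs , here refl = transfers-via-sound id id (λ mv → mv) (λ _ → refl) q∈xs
... | _ , q∈xs , there (here refl) = transfers-via-sound swap₁₂ swap₁₂ ⟶-swap₁₂ (λ _ → refl) q∈xs
... | _ , q∈xs , there (there (here refl)) = transfers-via-sound swap₂₃ swap₂₃ ⟶-swap₂₃ (λ _ → refl) q∈xs
... | _ , q∈xs , there (there (there (here refl))) =
  transfers-via-sound rotate rotate⁻¹ (⟶-swap₂₃ ∘ ⟶-swap₁₂) (λ _ → refl) q∈xs
... | _ , q∈xs , there (there (there (there (here refl)))) =
  transfers-via-sound rotate⁻¹ rotate (⟶-swap₁₂ ∘ ⟶-swap₂₃) (λ _ → refl) q∈xs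
... | _ , q∈xs , there (there (there (there (there (here refl))))) =
  transfers-via-sound swap₁₃ swap₁₃ (⟶-swap₁₂ ∘ ⟶-swap₂₃ ∘ ⟶-swap₁₂) (λ _ → refl) q∈xs

move-lists-complete : ∀ {p q} → p ⟶ q → ∃[ xs ] (q ∈ xs × xs ∈ move-lists p)
move-lists-complete (mv21 {a} {b} {c} {k} h h') =
  _ , ∈-map⁺ id (transfers₂₁-complete {a} {b} {c} {k} h h') , here refl
move-lists-complete (mv12 {a} {b} {c} {k} h h') =
  _ , ∈-map⁺ swap₁₂ (transfers₂₁-complete {b} {a} {c} {k} h h') , there (here refl)
move-lists-complete (mv31 {a} {b} {c} {k} h h') =
  _ , ∈-map⁺ swap₂₃ (transfers₂₁-complete {a} {c} {b} {k} h h') , there (there (here refl))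
move-lists-complete (mv13 {a} {b} {c} {k} h h') =
  _ , ∈-map⁺ rotate⁻¹ (transfers₂₁-complete {c} {a} {b} {k} h h') , there (there (there (here refl)))
move-lists-complete (mv32 {a} {b} {c} {k} h h') =
  _ , ∈-map⁺ rotate (transfers₂₁-complete {b} {c} {a} {k} h h') , there (there (there (there (here refl))))
move-lists-complete (mv23 {a} {b} {c} {k} h h') =
  _ , ∈-map⁺ swap₁₃ (transfers₂₁-complete {c} {b} {a} {k} h h') , there (there (there (there (there (here refl)))))

options-complete : ∀ {p q} → p ⟶ q → q ∈ options p
options-complete mv with move-lists-complete mv
... | _ , q∈xs , xs∈ = ∈-concat⁺′ q∈xs xs∈

Mex : List ℕ → ℕ → Set
Mex vs n = n ∉ vs × (∀ {m} → m < n → m ∈ vs)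

∈⇒≤sum : ∀ {m vs} → m ∈ vs → m ≤ sum vs
∈⇒≤sum {vs = v ∷ vs} (here refl) = m≤m+n v (sum vs)
∈⇒≤sum {vs = v ∷ vs} (there m∈) = ≤-trans (∈⇒≤sum m∈) (m≤n+m (sum vs) v)

mex-from : ∀ vs n fuel → sum vs < n + fuel → (∀ {m} → m < n → m ∈ vs) → ∃ (Mex vs)
mex-from vs n zero sum<n below = n , (λ n∈ → <⇒≱ (subst (sum vs <_) (+-identityʳ n) sum<n) (∈⇒≤sum n∈)) , below
mex-from vs n (suc fuel) sum<n+1+fuel below with n ∈? vs
... | no n∉ = n , n∉ , below
... | yes n∈ = mex-from vs (suc n) fuel (subst (sum vs <_) (+-suc n fuel) sum<n+1+fuel) below'
  where
  below' : ∀ {m} → m < suc n → m ∈ vs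
  below' m<1+n with m<1+n⇒m<n∨m≡n m<1+n
  ... | inj₁ m<n = below m<n
  ... | inj₂ refl = n∈

mex : ∀ vs → ∃ (Mex vs)
mex vs = mex-from vs 0 (suc (sum vs)) ≤-refl (λ ())

SG-unique : ∀ {p n m} → SG p n → SG p m → n ≡ m
SG-unique {n = n} {m} (sg options₁ below₁) (sg options₂ below₂) with <-cmp n m
... | tri≈ _ n≡m _ = n≡m
... | tri< n<m _ _ with below₂ n<m
...   | q , mv , dq with options₁ mv
...     | m' , dq' , m'≢n = ⊥-elim (m'≢n (SG-unique dq' dq))
SG-unique {n = n} {m} (sg options₁ below₁) (sg options₂ below₂) | tri> _ _ m<n with below₁ m<n
...   | q , mv , dq with options₂ mv
...     | m' , dq' , m'≢m = ⊥-elim (m'≢m (SG-unique dq' dq))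

SG-total : ∀ p → ∃ (SG p)
SG-total = ⟶-induction _ step
  where
  step : ∀ p → (∀ {q} → p ⟶ q → ∃ (SG q)) → ∃ (SG p)
  step p IH = n , sg option-values-≢ below-n-reached
    where
    value : ∀ {q} → q ∈ options p → ℕ
    value q∈ = proj₁ (IH (options-sound q∈))
    values : List ℕ
    values = mapWith∈ (options p) value
    n : ℕ
    n = proj₁ (mex values)
    option-values-≢ : ∀ {q} → p ⟶ q → ∃[ m ] (SG q m × m ≢ n)
    option-values-≢ mv with IH mv
    ... | m , d = m , d , λ m≡n → proj₁ (proj₂ (mex values))
      (mapWith∈⁺ value (_ , options-complete mv , trans (sym m≡n) (SG-unique d (proj₂ (IH (options-sound (options-complete mv)))))))
    below-n-reached : ∀ {m} → m < n → ∃[ q ] (p ⟶ q × SG q m)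
    below-n-reached m<n with mapWith∈⁻ (options p) value (proj₂ (proj₂ (mex values)) m<n)
    ... | q , q∈ , refl = q , options-sound q∈ , proj₂ (IH (options-sound q∈))

Independent : (Pos → Set) → Set
Independent A = ∀ {p q} → A p → p ⟶ q → ¬ A q

SG≡0-characterisation : (K : Pos → Set) → Independent K → (∀ p → K p ⊎ ∃[ q ] (p ⟶ q × K q)) →
                        ∀ p → SG p 0 ⇔ K p
SG≡0-characterisation K independent dominating = ⟶-induction _ step
  where
  step : ∀ p → (∀ {q} → p ⟶ q → SG q 0 ⇔ K q) → SG p 0 ⇔ K p
  step p IH = mk⇔ to from
    where
    to : SG p 0 → K p
    to (sg options-≢ _) with dominating p
    ... | inj₁ Kp = Kp
    ... | inj₂ (q , mv , Kq) with options-≢ mv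
    ...   | m , d , m≢0 = ⊥-elim (m≢0 (SG-unique d (Equivalence.from (IH mv) Kq)))
    from : K p → SG p 0
    from Kp = sg (λ {q} mv → let m , d = SG-total q in
                   m , d , λ m≡0 → independent Kp mv (Equivalence.to (IH mv) (subst (SG q) m≡0 d)))
                 (λ ())

SG≡1-characterisation : (A : Pos → Set) → Independent A → (∀ {p} → A p → ∃[ q ] (p ⟶ q × SG q 0)) →
                        (∀ p → A p ⊎ SG p 0 ⊎ ∃[ q ] (p ⟶ q × A q)) → ∀ p → SG p 1 ⇔ A p
SG≡1-characterisation A independent reaches-zero dominated = ⟶-induction _ step
  where
  step : ∀ p → (∀ {q} → p ⟶ q → SG q 1 ⇔ A q) → SG p 1 ⇔ A p
  step p IH = mk⇔ to from
    where
    to : SG p 1 → A p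
    to d@(sg options-≢ _) with dominated p
    ... | inj₁ Ap = Ap
    ... | inj₂ (inj₁ d₀) = ⊥-elim (0≢1+n (SG-unique d₀ d))
    ... | inj₂ (inj₂ (q , mv , Aq)) with options-≢ mv
    ...   | m , dm , m≢1 = ⊥-elim (m≢1 (SG-unique dm (Equivalence.from (IH mv) Aq)))
    from : A p → SG p 1
    from Ap = sg (λ {q} mv → let m , d = SG-total q in
                   m , d , λ m≡1 → independent Ap mv (Equivalence.to (IH mv) (subst (SG q) m≡1 d)))
                 (λ { (s≤s z≤n) → reaches-zero Ap })

lift-Reaches : ∀ {X : Gaps → Set} {p} → Reaches X (gaps p) → ∃[ q ] (p ⟶ q × X (gaps q))
lift-Reaches (_ , mv , x) with lift mv
... | q , mv' , refl = q , mv' , x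

SG≡0⇔Value₀ : ∀ p → SG p 0 ⇔ Value₀ (gaps p)
SG≡0⇔Value₀ = SG≡0-characterisation (Value₀ ∘ gaps) (λ P mv → Value₀-independent P (project mv))
                (λ p → Sum.map₂ lift-Reaches (Value₀-dominating (gaps p)))

SG≡1⇔Value₁ : ∀ p → SG p 1 ⇔ Value₁ (gaps p)
SG≡1⇔Value₁ = SG≡1-characterisation (Value₁ ∘ gaps) (λ A mv → Value₁-independent A (project mv))
                reaches-value-0 dominated
  where
  reaches-value-0 : ∀ {p} → Value₁ (gaps p) → ∃[ q ] (p ⟶ q × SG q 0)
  reaches-value-0 A with lift-Reaches (Value₁-reaches-Value₀ A)
  ... | q , mv , P = q , mv , Equivalence.from (SG≡0⇔Value₀ q) P
  dominated : ∀ p → Value₁ (gaps p) ⊎ SG p 0 ⊎ ∃[ q ] (p ⟶ q × Value₁ (gaps q))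
  dominated p = Sum.map₂ (Sum.map (Equivalence.from (SG≡0⇔Value₀ p)) lift-Reaches) (Value₁-dominating (gaps p))

SG≡1⇔Value₁-sorted : ∀ a u v → SG (a , a + u , a + u + v) 1 ⇔ Value₁ (u , v)
SG≡1⇔Value₁-sorted a u v = subst (λ w → SG (a , a + u , a + u + v) 1 ⇔ Value₁ w) (gaps-of a refl refl) (SG≡1⇔Value₁ _)

Value₁-Multiset : ℕ → ℕ → Set
Value₁-Multiset d e =
  (Σ ℕ λ k → (0 ∷ d ∷ e ∷ []) ↭ (0 ∷ 0 ∷ 4 * k + 2 ∷ []))
  ⊎ (Σ ℕ λ k → (0 ∷ d ∷ e ∷ []) ↭ (0 ∷ 4 * k + 2 ∷ 4 * k + 2 ∷ []))
  ⊎ (Σ ℕ λ k → (0 ∷ d ∷ e ∷ []) ↭ (0 ∷ 2 ∷ 4 * k + 1 ∷ []))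
  ⊎ (Σ ℕ λ l → 1 ≤ l × (0 ∷ d ∷ e ∷ []) ↭ (0 ∷ 4 * l ∸ 1 ∷ 4 * l + 1 ∷ []))

↭-sorted-triple : ∀ {d e a b} → (0 ∷ d ∷ e ∷ []) ↭ (0 ∷ a ∷ b ∷ []) → d ≤ e → a ≤ b → d ≡ a × e ≡ b
↭-sorted-triple perm d≤e a≤b with ≋⇒≡ (↗↭↗⇒≋ ≤-totalOrder (z≤n ∷↗ d≤e ∷↗ [-]) (z≤n ∷↗ a≤b ∷↗ [-]) (↭⇒↭ₛ perm))
... | refl = refl , refl

[0,4l∸1,4l+1]≡ : ∀ k → (0 ∷ 4 * suc k ∸ 1 ∷ 4 * suc k + 1 ∷ []) ≡ (0 ∷ 4 * k + 3 ∷ 4 * k + 3 + 2 ∷ [])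
[0,4l∸1,4l+1]≡ k = cong₂ (λ d e → 0 ∷ d ∷ e ∷ []) 4[1+k]∸1≡4k+3 4[1+k]+1≡4k+3+2
  where
  4[1+k]+1≡4k+3+2 : 4 * suc k + 1 ≡ 4 * k + 3 + 2
  4[1+k]+1≡4k+3+2 = solve (k ∷ [])
  4[1+k]≡4k+3+1 : 4 * suc k ≡ 4 * k + 3 + 1
  4[1+k]≡4k+3+1 = solve (k ∷ [])
  4[1+k]∸1≡4k+3 : 4 * suc k ∸ 1 ≡ 4 * k + 3
  4[1+k]∸1≡4k+3 = trans (cong (_∸ 1) 4[1+k]≡4k+3+1) (m+n∸n≡m (4 * k + 3) 1)

2+[4k+3]≡4[1+k]+1 : ∀ k → 2 + (4 * k + 3) ≡ 4 * suc k + 1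
2+[4k+3]≡4[1+k]+1 = solve-∀

Value₁⇒Multiset : ∀ {u v} → Value₁ (u , v) → Value₁-Multiset u (u + v)
Value₁⇒Multiset ([0,4k+2] k refl refl) = inj₁ (k , ↭-refl)
Value₁⇒Multiset ([4k+2,0] k refl refl) =
  inj₂ (inj₁ (k , ↭-reflexive (cong (λ e → 0 ∷ 4 * k + 2 ∷ e ∷ []) (+-identityʳ (4 * k + 2)))))
Value₁⇒Multiset ([1,1] refl refl) = inj₂ (inj₂ (inj₁ (0 , ↭-prep 0 (↭-swap 1 2 ↭-refl))))
Value₁⇒Multiset ([2,4k+3] k refl refl) =
  inj₂ (inj₂ (inj₁ (suc k , ↭-reflexive (cong (λ e → 0 ∷ 2 ∷ e ∷ []) (2+[4k+3]≡4[1+k]+1 k)))))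
Value₁⇒Multiset ([4k+3,2] k refl refl) =
  inj₂ (inj₂ (inj₂ (suc k , s≤s z≤n , ↭-reflexive (sym ([0,4l∸1,4l+1]≡ k)))))

second-summand-≡ : ∀ {u v a b} → u ≡ a → u + v ≡ a + b → v ≡ b
second-summand-≡ {v = v} {a} {b} refl = +-cancelˡ-≡ a v b

Multiset⇒Value₁ : ∀ {u v} → Value₁-Multiset u (u + v) → Value₁ (u , v)
Multiset⇒Value₁ {u} {v} (inj₁ (k , perm)) =
  let u≡ , u+v≡ = ↭-sorted-triple perm (m≤m+n u v) z≤n
  in [0,4k+2] k u≡ (second-summand-≡ u≡ u+v≡)
Multiset⇒Value₁ {u} {v} (inj₂ (inj₁ (k , perm))) =
  let u≡ , u+v≡ = ↭-sorted-triple perm (m≤m+n u v) ≤-refl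
  in [4k+2,0] k u≡ (second-summand-≡ u≡ (trans u+v≡ (sym (+-identityʳ _))))
Multiset⇒Value₁ {u} {v} (inj₂ (inj₂ (inj₁ (zero , perm)))) =
  let u≡ , u+v≡ = ↭-sorted-triple (↭-trans perm (↭-prep 0 (↭-swap 2 1 ↭-refl))) (m≤m+n u v) (s≤s z≤n)
  in [1,1] u≡ (second-summand-≡ u≡ u+v≡)
Multiset⇒Value₁ {u} {v} (inj₂ (inj₂ (inj₁ (suc k , perm)))) =
  let u≡ , u+v≡ = ↭-sorted-triple perm (m≤m+n u v) (≤-trans (m≤m+n 2 (4 * k + 3)) (≤-reflexive (2+[4k+3]≡4[1+k]+1 k)))
  in [2,4k+3] k u≡ (second-summand-≡ u≡ (trans u+v≡ (sym (2+[4k+3]≡4[1+k]+1 k))))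
Multiset⇒Value₁ (inj₂ (inj₂ (inj₂ (zero , () , _))))
Multiset⇒Value₁ {u} {v} (inj₂ (inj₂ (inj₂ (suc k , _ , perm)))) =
  let u≡ , u+v≡ = ↭-sorted-triple (↭-trans perm (↭-reflexive ([0,4l∸1,4l+1]≡ k))) (m≤m+n u v) (m≤m+n (4 * k + 3) 2)
  in [4k+3,2] k u≡ (second-summand-≡ u≡ u+v≡)

Value₁⇔Multiset : ∀ u v → Value₁ (u , v) ⇔ Value₁-Multiset u (u + v)
Value₁⇔Multiset u v = mk⇔ Value₁⇒Multiset Multiset⇒Value₁

m+n+o∸m≡n+o : ∀ m n o → m + n + o ∸ m ≡ n + o
m+n+o∸m≡n+o m n o = trans (cong (_∸ m) (+-assoc m n o)) (m+n∸m≡n m (n + o))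

mainTheorem10 : (x y z : ℕ) → x ≤ y → y ≤ z →
    SG (x , y , z) 1 ⇔
      ((Σ ℕ λ k → (0 ∷ y ∸ x ∷ z ∸ x ∷ []) ↭ (0 ∷ 0 ∷ 4 * k + 2 ∷ []))
      ⊎ (Σ ℕ λ k → (0 ∷ y ∸ x ∷ z ∸ x ∷ []) ↭ (0 ∷ 4 * k + 2 ∷ 4 * k + 2 ∷ []))
      ⊎ (Σ ℕ λ k → (0 ∷ y ∸ x ∷ z ∸ x ∷ []) ↭ (0 ∷ 2 ∷ 4 * k + 1 ∷ []))
      ⊎ (Σ ℕ λ l → 1 ≤ l × (0 ∷ y ∸ x ∷ z ∸ x ∷ []) ↭ (0 ∷ 4 * l ∸ 1 ∷ 4 * l + 1 ∷ [])))
mainTheorem10 x _ _ x≤y y≤z with m≤n⇒∃[o]m+o≡n x≤y | m≤n⇒∃[o]m+o≡n y≤z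
... | u , refl | v , refl rewrite m+n∸m≡n x u | m+n+o∸m≡n+o x u v =
  ⇔-trans (SG≡1⇔Value₁-sorted x u v) (Value₁⇔Multiset u v)
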